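{- Let $d \geq 7$ and $k \geq 1$ be integers. Then Player $A$ has a winning strategy in the game $Z(n,d)$ for every $n$ such that: (1) if $d$ is even, $n \in \{kd-1,\ (k+1)d+1,\ (k+3)d-3\}$; (2) if $d$ is odd, $n \in \{(2k-1)d-2,\ (2k-1)d,\ 2kd-1,\ 2kd+1,\ (2k+1)d+2,\ 2(k+1)d-3\}$.
   Context: For integers $n \geq 4$ and $d \geq 2$, $Z(n,d)$ is the following two-player game. Initially the board contains the numbers $1,2,\dots,n$. Players $A$ and $B$ alternately cross out (remove) one number from the board, with $A$ moving first, until exactly two numbers remain. If the sum of the two remaining numbers is divisible by $d$, $A$ wins; otherwise $B$ wins. A player has a winning strategy if that player can force a win regardless of the opponent's moves. -}

module Defs where

open import Data.Nat using (ℕ; suc; _+_; _≤_)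
open import Data.Nat.Divisibility using (_∣_)
open import Data.List using (List; []; _∷_; length; map; upTo; removeAt)
open import Data.Fin using (Fin)

data Player : Set where
  A B : Player

-- AForces d p b : on board b (list of remaining numbers) with player p to
-- move, player A can force a win in the game "cross out one number per turn
-- until exactly two remain; A wins iff d divides their sum".
data AForces (d : ℕ) : Player → List ℕ → Set where
  done  : ∀ {p x y} → d ∣ x + y → AForces d p (x ∷ y ∷ [])
  moveA : ∀ {b} → 3 ≤ length b → (i : Fin (length b)) →
          AForces d B (removeAt b i) → AForces d A b
  moveB : ∀ {b} → 3 ≤ length b → (∀ (i : Fin (length b)) → AForces d A (removeAt b i)) →
          AForces d B b

board : ℕ → List ℕ
board n = map suc (upTo n)

AWinsZ : ℕ → ℕ → Set
AWinsZ n d = AForces d A (board n)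

-- Call a sub-board free if no two of its numbers sum to a multiple of D. A largest free
-- sub-board takes at most one number from class 0 and from the middle class D/2 and the larger of
-- the residue classes r and D − r; call its size α. With an odd number L of numbers left and A to
-- move, A wins as soon as 2α ≤ L + 1: if two complementary classes have different sizes, or class 0
-- or the middle class holds exactly one number, A removes a number that lowers α; otherwise
-- already 2α ≤ L, so 2α ≤ L − 1 by parity and any move will do. B's moves never raise α, so when
-- two numbers remain α ≤ 1, i.e. they sum to a multiple of D. For n = qD + ρ the class sizes are
-- q + [1 ≤ r ≤ ρ], and 2α ≤ n + 1 follows from
--   2·[q > 0] + #{pairs r < D − r with r ≤ ρ < D − r} + [the middle class holds one number] ≤ q + 1,
-- which holds for every n in the statement.
module Submission where

open import Defs
open import Data.Nat using (ℕ; zero; suc; _+_; _*_; _∸_; _≤_; _<_; _⊔_; ∣_-_∣; z≤n; s≤s; pred; _≟_)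
open import Data.Nat.Properties
open import Data.Nat.Divisibility using (_∣_; divides; m%n≡0⇒n∣m)
open import Data.Nat.DivMod using (_%_; m%n<n; %-distribˡ-+; n%n≡0; [m+kn]%n≡m%n; m<n⇒m%n≡m)
open import Data.Nat.Tactic.RingSolver using (solve-∀)
open import Data.List using (List; []; _∷_; length; map; upTo; removeAt; lookup; _++_; [_])
open import Data.List.Properties using (length-removeAt; length-removeAt′; upTo-∷ʳ; map-++; length-map; length-upTo)
open import Data.Fin using (Fin; zero; suc)
open import Data.Product using (_×_; _,_; proj₁; proj₂; Σ-syntax)
open import Data.Sum using (_⊎_; inj₁; inj₂)
open import Data.Empty using (⊥-elim)
open import Relation.Nullary using (¬_; yes; no)
open import Relation.Binary.Definitions using (tri<; tri≈; tri>)
open import Relation.Binary.PropositionalEquality hiding ([_])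
open import Function using (_∘_)

δ : ℕ → ℕ → ℕ
δ zero    zero    = 1
δ zero    (suc _) = 0
δ (suc _) zero    = 0
δ (suc a) (suc b) = δ a b

δ-same : ∀ a → δ a a ≡ 1
δ-same zero    = refl
δ-same (suc a) = δ-same a

δ-diff : ∀ {a b} → a ≢ b → δ a b ≡ 0
δ-diff {zero}  {zero}  a≢b = ⊥-elim (a≢b refl)
δ-diff {zero}  {suc _} _   = refl
δ-diff {suc _} {zero}  _   = refl
δ-diff {suc a} {suc b} a≢b = δ-diff (a≢b ∘ cong suc)

𝟙[_<_] : ℕ → ℕ → ℕ
𝟙[ r     < zero  ] = 0
𝟙[ zero  < suc ρ ] = 1
𝟙[ suc r < suc ρ ] = 𝟙[ r < ρ ]

𝟙<-yes : ∀ {r ρ} → r < ρ → 𝟙[ r < ρ ] ≡ 1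
𝟙<-yes {zero}  {suc ρ} _         = refl
𝟙<-yes {suc r} {suc ρ} (s≤s r<ρ) = 𝟙<-yes r<ρ

𝟙<-no : ∀ {r ρ} → ρ ≤ r → 𝟙[ r < ρ ] ≡ 0
𝟙<-no {r}     {zero}  _         = refl
𝟙<-no {suc r} {suc ρ} (s≤s ρ≤r) = 𝟙<-no ρ≤r

𝟙<-suc : ∀ r ρ → 𝟙[ r < suc ρ ] ≡ 𝟙[ r < ρ ] + δ ρ r
𝟙<-suc zero    zero    = refl
𝟙<-suc zero    (suc ρ) = refl
𝟙<-suc (suc r) zero    = refl
𝟙<-suc (suc r) (suc ρ) = 𝟙<-suc r ρ

sgn : ℕ → ℕ
sgn zero    = 0
sgn (suc _) = 1

sgn-mono : ∀ {a b} → a ≤ b → sgn a ≤ sgn b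
sgn-mono {zero}          _ = z≤n
sgn-mono {suc _} {suc _} _ = ≤-refl

2*sgn≤n+δn1 : ∀ v → 2 * sgn v ≤ v + δ v 1
2*sgn≤n+δn1 zero          = z≤n
2*sgn≤n+δn1 (suc zero)    = ≤-refl
2*sgn≤n+δn1 (suc (suc v)) = s≤s (s≤s z≤n)

2*[m⊔n]≡m+n+∣m-n∣ : ∀ m n → 2 * (m ⊔ n) ≡ m + n + ∣ m - n ∣
2*[m⊔n]≡m+n+∣m-n∣ zero    n       = cong (n +_) (+-identityʳ n)
2*[m⊔n]≡m+n+∣m-n∣ (suc m) zero    = sym (+-comm (suc m + 0) (suc m))
2*[m⊔n]≡m+n+∣m-n∣ (suc m) (suc n) = cong suc (begin
  m ⊔ n + suc (m ⊔ n + 0)  ≡⟨ +-suc (m ⊔ n) _ ⟩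
  suc (2 * (m ⊔ n))        ≡⟨ cong suc (2*[m⊔n]≡m+n+∣m-n∣ m n) ⟩
  suc (m + n) + ∣ m - n ∣  ≡⟨ cong (_+ ∣ m - n ∣) (sym (+-suc m n)) ⟩
  m + suc n + ∣ m - n ∣    ∎)
  where open ≡-Reasoning

InRange : ℕ → ℕ → ℕ → Set
InRange lo len r = lo ≤ r × r < lo + len

module _ {lo len : ℕ} where

  range-lo : InRange lo (2 + len) lo
  range-lo = ≤-refl , m<m+n lo (s≤s z≤n)

  range-hi : InRange lo (2 + len) (lo + suc len)
  range-hi = m≤m+n lo (suc len) , +-monoʳ-< lo ≤-refl

  range-hi≢lo : lo + suc len ≢ lo
  range-hi≢lo e = <-irrefl (sym e) (m<m+n lo (s≤s z≤n))

  module _ {r : ℕ} (r∈ : InRange (suc lo) len r) where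

    range-inner : InRange lo (2 + len) r
    range-inner = <⇒≤ (proj₁ r∈) ,
                  ≤-trans (proj₂ r∈) (≤-trans (n≤1+n _)
                    (≤-reflexive (sym (trans (+-suc lo (suc len)) (cong suc (+-suc lo len))))))

    inner≢lo : r ≢ lo
    inner≢lo refl = <-irrefl refl (proj₁ r∈)

    inner≢hi : r ≢ lo + suc len
    inner≢hi refl = <-irrefl (+-suc lo len) (proj₂ r∈)

  range-split : ∀ {r} → InRange lo (2 + len) r →
                (r ≡ lo ⊎ r ≡ lo + suc len) ⊎ InRange (suc lo) len r
  range-split {r} (lo≤r , r<) with r ≟ lo | r ≟ lo + suc len
  ... | yes r≡lo | _        = inj₁ (inj₁ r≡lo)
  ... | no _     | yes r≡hi = inj₁ (inj₂ r≡hi)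
  ... | no r≢lo  | no r≢hi  = inj₂ (≤∧≢⇒< lo≤r (r≢lo ∘ sym) ,
         subst (r <_) (+-suc lo len) (≤∧≢⇒< (≤-pred (subst (r <_) (+-suc lo (suc len)) r<)) r≢hi))

range-single : ∀ {lo r} → InRange lo 1 r → r ≡ lo
range-single {lo} {r} (lo≤r , r<) = ≤-antisym (≤-pred (subst (r <_) (+-comm lo 1) r<)) lo≤r

range-empty : ∀ {lo r} → ¬ InRange lo 0 r
range-empty {lo} {r} (lo≤r , r<) = <-irrefl refl (≤-<-trans lo≤r (subst (r <_) (+-identityʳ lo) r<))

-- Folds the classes lo, …, lo + len − 1 from the outside in, pairing lo with lo + len − 1; for
-- lo = 1 and len = D − 1 the pairs are the complementary classes r, D − r, and mid handles the
-- unpaired middle class.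
pairFold : (ℕ → ℕ) → (ℕ → ℕ → ℕ) → (ℕ → ℕ) → ℕ → ℕ → ℕ
pairFold mid pair c lo zero            = 0
pairFold mid pair c lo (suc zero)      = mid (c lo)
pairFold mid pair c lo (suc (suc len)) = pair (c lo) (c (lo + suc len)) + pairFold mid pair c (suc lo) len

pairFold-cong : ∀ {mid pair} len lo {c c′ : ℕ → ℕ} →
                (∀ {r} → InRange lo len r → c′ r ≡ c r) →
                pairFold mid pair c′ lo len ≡ pairFold mid pair c lo len
pairFold-cong zero            lo eq = refl
pairFold-cong {mid} (suc zero) lo eq = cong mid (eq (≤-refl , m<m+n lo (s≤s z≤n)))
pairFold-cong {pair = pair} (suc (suc len)) lo eq =
  cong₂ _+_ (cong₂ pair (eq range-lo) (eq range-hi)) (pairFold-cong len (suc lo) (eq ∘ range-inner))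

pairMax classSum pairDefect : (ℕ → ℕ) → ℕ → ℕ → ℕ
pairMax    = pairFold sgn _⊔_
classSum   = pairFold (λ v → v) _+_
pairDefect = pairFold (λ v → δ v 1) ∣_-_∣

pairMax-mono : ∀ len lo {c c′ : ℕ → ℕ} → (∀ r → c′ r ≤ c r) → pairMax c′ lo len ≤ pairMax c lo len
pairMax-mono zero            lo le = z≤n
pairMax-mono (suc zero)      lo le = sgn-mono (le lo)
pairMax-mono (suc (suc len)) lo le = +-mono-≤ (⊔-mono-≤ (le lo) (le _)) (pairMax-mono len (suc lo) le)

pairMax-bound : ∀ len lo c → 2 * pairMax c lo len ≤ classSum c lo len + pairDefect c lo len
pairMax-bound zero            lo c = z≤n
pairMax-bound (suc zero)      lo c = 2*sgn≤n+δn1 (c lo)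
pairMax-bound (suc (suc len)) lo c = begin
  2 * (x ⊔ y + S)                       ≡⟨ *-distribˡ-+ 2 (x ⊔ y) S ⟩
  2 * (x ⊔ y) + 2 * S                   ≤⟨ +-mono-≤ (≤-reflexive (2*[m⊔n]≡m+n+∣m-n∣ x y))
                                                    (pairMax-bound len (suc lo) c) ⟩
  (x + y + ∣ x - y ∣) + (T + E)         ≡⟨ shuffle (x + y) ∣ x - y ∣ T E ⟩
  (x + y + T) + (∣ x - y ∣ + E)         ∎
  where
  open ≤-Reasoning
  x = c lo
  y = c (lo + suc len)
  S = pairMax c (suc lo) len
  T = classSum c (suc lo) len
  E = pairDefect c (suc lo) len
  shuffle : ∀ a b t e → (a + b) + (t + e) ≡ (a + t) + (b + e)
  shuffle = solve-∀

pairDefect-const-even : ∀ j lo v → pairDefect (λ _ → v) lo (j * 2) ≡ 0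
pairDefect-const-even zero    lo v = refl
pairDefect-const-even (suc j) lo v = cong₂ _+_ (∣n-n∣≡0 v) (pairDefect-const-even j (suc lo) v)

pairDefect-const-odd : ∀ j lo v → pairDefect (λ _ → v) lo (suc (j * 2)) ≡ δ v 1
pairDefect-const-odd zero    lo v = refl
pairDefect-const-odd (suc j) lo v = cong₂ _+_ (∣n-n∣≡0 v) (pairDefect-const-odd j (suc lo) v)

classSum-+ : ∀ len lo {c e f : ℕ → ℕ} → (∀ r → c r ≡ e r + f r) →
             classSum c lo len ≡ classSum e lo len + classSum f lo len
classSum-+ zero            lo eq = refl
classSum-+ (suc zero)      lo eq = eq lo
classSum-+ (suc (suc len)) lo {c} {e} {f} eq
  rewrite eq lo | eq (lo + suc len) | classSum-+ len (suc lo) {c} {e} {f} eq =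
    shuffle (e lo) (f lo) (e (lo + suc len)) (f (lo + suc len)) (classSum e (suc lo) len) (classSum f (suc lo) len)
  where
  shuffle : ∀ a b p q s t → ((a + b) + (p + q)) + (s + t) ≡ ((a + p) + s) + ((b + q) + t)
  shuffle = solve-∀

classSum-const0 : ∀ len lo → classSum (λ _ → 0) lo len ≡ 0
classSum-const0 zero            lo = refl
classSum-const0 (suc zero)      lo = refl
classSum-const0 (suc (suc len)) lo = classSum-const0 len (suc lo)

classSum-vanishing : ∀ len lo {c : ℕ → ℕ} → (∀ {r} → InRange lo len r → c r ≡ 0) →
                     classSum c lo len ≡ 0
classSum-vanishing len lo eq = trans (pairFold-cong len lo eq) (classSum-const0 len lo)

classSum-δ : ∀ len lo {a} → InRange lo len a → classSum (δ a) lo len ≡ 1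
classSum-δ zero            lo a∈ = ⊥-elim (range-empty a∈)
classSum-δ (suc zero)      lo a∈ rewrite range-single a∈ = δ-same lo
classSum-δ (suc (suc len)) lo a∈ with range-split a∈
... | inj₁ (inj₁ refl) = cong₂ _+_ (cong₂ _+_ (δ-same lo) (δ-diff (range-hi≢lo {lo} {len} ∘ sym)))
                            (classSum-vanishing len (suc lo) (λ r∈ → δ-diff (inner≢lo r∈ ∘ sym)))
... | inj₁ (inj₂ refl) = cong₂ _+_ (cong₂ _+_ (δ-diff (range-hi≢lo {lo} {len})) (δ-same (lo + suc len)))
                                   (classSum-vanishing len (suc lo) (λ r∈ → δ-diff (inner≢hi r∈ ∘ sym)))
... | inj₂ a∈′ = cong₂ _+_ (cong₂ _+_ (δ-diff (inner≢lo a∈′)) (δ-diff (inner≢hi a∈′)))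
                                  (classSum-δ len (suc lo) a∈′)

Removal : ℕ → (ℕ → ℕ) → (ℕ → ℕ) → Set
Removal a c′ c = ∀ r → δ a r + c′ r ≡ c r

removal-self : ∀ {a c′ c} → Removal a c′ c → suc (c′ a) ≡ c a
removal-self {a} {c′} rem = trans (cong (_+ c′ a) (sym (δ-same a))) (rem a)

removal-other : ∀ {a c′ c r} → Removal a c′ c → a ≢ r → c′ r ≡ c r
removal-other {a} {c′} {r = r} rem a≢r = trans (cong (_+ c′ r) (sym (δ-diff a≢r))) (rem r)

removal-≤ : ∀ {a c′ c} → Removal a c′ c → ∀ r → c′ r ≤ c r
removal-≤ {a} {c′} rem r = subst (c′ r ≤_) (rem r) (m≤n+m (c′ r) (δ a r))

record Reducible (Allowed : ℕ → Set) (f : (ℕ → ℕ) → ℕ) (c : ℕ → ℕ) : Set where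
  constructor reducible
  field
    class    : ℕ
    allowed  : Allowed class
    occupied : 1 ≤ c class
    reduces  : ∀ {c′} → Removal class c′ c → f c′ < f c

suc[m⊔n]≡suc[m]⊔n : ∀ {m n} → n ≤ m → suc (m ⊔ n) ≡ suc m ⊔ n
suc[m⊔n]≡suc[m]⊔n n≤m = trans (cong suc (m≥n⇒m⊔n≡m n≤m)) (sym (m≥n⇒m⊔n≡m (m≤n⇒m≤1+n n≤m)))

suc[m⊔n]≡m⊔suc[n] : ∀ {m n} → m ≤ n → suc (m ⊔ n) ≡ m ⊔ suc n
suc[m⊔n]≡m⊔suc[n] m≤n = trans (cong suc (m≤n⇒m⊔n≡n m≤n)) (sym (m≤n⇒m⊔n≡n (m≤n⇒m≤1+n m≤n)))

pairMax-reducible-or-balanced : ∀ len lo c →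
  Reducible (InRange lo len) (λ c′ → pairMax c′ lo len) c ⊎ 2 * pairMax c lo len ≤ classSum c lo len
pairMax-reducible-or-balanced zero lo c = inj₂ z≤n
pairMax-reducible-or-balanced (suc zero) lo c with c lo in eq
... | zero        = inj₂ z≤n
... | suc (suc _) = inj₂ (s≤s (s≤s z≤n))
... | suc zero    = inj₁ (reducible lo (≤-refl , m<m+n lo (s≤s z≤n)) (≤-reflexive (sym eq)) emptied)
  where
  emptied : ∀ {c′} → Removal lo c′ c → sgn (c′ lo) < sgn (c lo)
  emptied rem rewrite eq | suc-injective (trans (removal-self rem) eq) = ≤-refl
pairMax-reducible-or-balanced (suc (suc len)) lo c with <-cmp (c lo) (c (lo + suc len))
... | tri> _ _ hi<lo = inj₁ (reducible lo range-lo (≤-trans (s≤s z≤n) hi<lo) (≤-reflexive ∘ lower-lo))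
  where
  lower-lo : ∀ {c′} → Removal lo c′ c → suc (pairMax c′ lo (2 + len)) ≡ pairMax c lo (2 + len)
  lower-lo {c′} rem = begin
    suc (c′ lo ⊔ c′ hi) + pairMax c′ (suc lo) len
      ≡⟨ cong₂ (λ u v → suc (c′ lo ⊔ u) + v) (removal-other rem (range-hi≢lo ∘ sym))
               (pairFold-cong len (suc lo) (removal-other rem ∘ (_∘ sym) ∘ inner≢lo)) ⟩
    suc (c′ lo ⊔ c hi) + pairMax c (suc lo) len
      ≡⟨ cong (_+ _) (suc[m⊔n]≡suc[m]⊔n (≤-pred (subst (c hi <_) (sym (removal-self rem)) hi<lo))) ⟩
    (suc (c′ lo) ⊔ c hi) + pairMax c (suc lo) len
      ≡⟨ cong (λ u → u ⊔ c hi + pairMax c (suc lo) len) (removal-self rem) ⟩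
    c lo ⊔ c hi + pairMax c (suc lo) len ∎
    where
    open ≡-Reasoning
    hi = lo + suc len
... | tri< lo<hi _ _ =
  inj₁ (reducible (lo + suc len) range-hi (≤-trans (s≤s z≤n) lo<hi) (≤-reflexive ∘ lower-hi))
  where
  lower-hi : ∀ {c′} → Removal (lo + suc len) c′ c → suc (pairMax c′ lo (2 + len)) ≡ pairMax c lo (2 + len)
  lower-hi {c′} rem = begin
    suc (c′ lo ⊔ c′ hi) + pairMax c′ (suc lo) len
      ≡⟨ cong₂ (λ u v → suc (u ⊔ c′ hi) + v) (removal-other rem range-hi≢lo)
               (pairFold-cong len (suc lo) (removal-other rem ∘ (_∘ sym) ∘ inner≢hi)) ⟩
    suc (c lo ⊔ c′ hi) + pairMax c (suc lo) len
      ≡⟨ cong (_+ _) (suc[m⊔n]≡m⊔suc[n] (≤-pred (subst (c lo <_) (sym (removal-self rem)) lo<hi))) ⟩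
    (c lo ⊔ suc (c′ hi)) + pairMax c (suc lo) len
      ≡⟨ cong (λ u → c lo ⊔ u + pairMax c (suc lo) len) (removal-self rem) ⟩
    c lo ⊔ c hi + pairMax c (suc lo) len ∎
    where
    open ≡-Reasoning
    hi = lo + suc len
... | tri≈ _ lo≡hi _ with pairMax-reducible-or-balanced len (suc lo) c
...   | inj₁ (reducible a a∈ occupied reduces) =
        inj₁ (reducible a (range-inner a∈) occupied (λ rem → lower-inner rem (reduces rem)))
  where
  lower-inner : ∀ {c′} → Removal a c′ c → pairMax c′ (suc lo) len < pairMax c (suc lo) len →
                pairMax c′ lo (2 + len) < pairMax c lo (2 + len)
  lower-inner {c′} rem lt rewrite removal-other rem (inner≢lo a∈) | removal-other rem (inner≢hi a∈) =
    subst (_≤ ends + pairMax c (suc lo) len) (+-suc ends (pairMax c′ (suc lo) len)) (+-monoʳ-≤ ends lt)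
    where ends = c lo ⊔ c (lo + suc len)
...   | inj₂ balanced = inj₂ (begin
        2 * (c lo ⊔ c hi + S)  ≡⟨ cong (λ u → 2 * (c lo ⊔ u + S)) (sym lo≡hi) ⟩
        2 * (c lo ⊔ c lo + S)  ≡⟨ cong (λ u → 2 * (u + S)) (⊔-idem (c lo)) ⟩
        2 * (c lo + S)         ≡⟨ double (c lo) S ⟩
        (c lo + c lo) + 2 * S  ≤⟨ +-monoʳ-≤ (c lo + c lo) balanced ⟩
        (c lo + c lo) + T      ≡⟨ cong (λ u → (c lo + u) + T) lo≡hi ⟩
        (c lo + c hi) + T      ∎)
  where
  open ≤-Reasoning
  hi = lo + suc len
  S  = pairMax c (suc lo) len
  T  = classSum c (suc lo) len
  double : ∀ x s → 2 * (x + s) ≡ (x + x) + 2 * s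
  double = solve-∀

end≤⊔ : ∀ (c : ℕ → ℕ) {lo len a} → a ≡ lo ⊎ a ≡ lo + suc len → c a ≤ c lo ⊔ c (lo + suc len)
end≤⊔ c {lo} {len} (inj₁ refl) = m≤m⊔n (c lo) (c (lo + suc len))
end≤⊔ c {lo} {len} (inj₂ refl) = m≤n⊔m (c lo) (c (lo + suc len))

module _ {lo len a : ℕ} where

  ends-paired : ∀ {b} → a ≡ lo ⊎ a ≡ lo + suc len → b ≡ lo ⊎ b ≡ lo + suc len → a ≢ b →
                suc (a + b) ≡ lo + lo + (2 + len)
  ends-paired (inj₁ refl) (inj₁ refl) a≢b = ⊥-elim (a≢b refl)
  ends-paired (inj₁ refl) (inj₂ refl) _   = lo+hi lo len
    where
    lo+hi : ∀ l n → suc (l + (l + suc n)) ≡ l + l + (2 + n)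
    lo+hi = solve-∀
  ends-paired (inj₂ refl) (inj₁ refl) _   = hi+lo lo len
    where
    hi+lo : ∀ l n → suc ((l + suc n) + l) ≡ l + l + (2 + n)
    hi+lo = solve-∀
  ends-paired (inj₂ refl) (inj₂ refl) a≢b = ⊥-elim (a≢b refl)

shift-pair-sum : ∀ {s} lo len → s ≡ suc lo + suc lo + len → s ≡ lo + lo + (2 + len)
shift-pair-sum {s} lo len eq = trans eq (shift lo len)
  where
  shift : ∀ l n → suc l + suc l + n ≡ l + l + (2 + n)
  shift = solve-∀

pairMax-≥1 : ∀ len lo c {a} → InRange lo len a → 1 ≤ c a → 1 ≤ pairMax c lo len
pairMax-≥1 zero            lo c a∈ _ = ⊥-elim (range-empty a∈)
pairMax-≥1 (suc zero)      lo c a∈ ca rewrite range-single a∈ = sgn-mono ca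
pairMax-≥1 (suc (suc len)) lo c a∈ ca with range-split a∈
... | inj₁ a-end = ≤-trans (≤-trans ca (end≤⊔ c {lo} {len} a-end)) (m≤m+n _ _)
... | inj₂ a∈′   = ≤-trans (pairMax-≥1 len (suc lo) c a∈′ ca) (m≤n+m _ _)

-- suc (a + b) ≡ lo + lo + len says that a and b are paired with each other.
pairMax-≥2-repeated : ∀ len lo c {a} → InRange lo len a → suc (a + a) ≢ lo + lo + len →
                      2 ≤ c a → 2 ≤ pairMax c lo len
pairMax-≥2-repeated zero            lo c a∈ _ _ = ⊥-elim (range-empty a∈)
pairMax-≥2-repeated (suc zero)      lo c a∈ unpaired _ rewrite range-single a∈ =
  ⊥-elim (unpaired (+-comm 1 (lo + lo)))
pairMax-≥2-repeated (suc (suc len)) lo c a∈ unpaired ca with range-split a∈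
... | inj₁ a-end = ≤-trans (≤-trans ca (end≤⊔ c {lo} {len} a-end)) (m≤m+n _ _)
... | inj₂ a∈′   = ≤-trans (pairMax-≥2-repeated len (suc lo) c a∈′ (unpaired ∘ shift-pair-sum lo len) ca)
                           (m≤n+m _ _)

pairMax-≥2-distinct : ∀ len lo c {a b} → InRange lo len a → InRange lo len b → a ≢ b →
                      suc (a + b) ≢ lo + lo + len → 1 ≤ c a → 1 ≤ c b → 2 ≤ pairMax c lo len
pairMax-≥2-distinct zero            lo c a∈ _ _ _ _ _ = ⊥-elim (range-empty a∈)
pairMax-≥2-distinct (suc zero)      lo c a∈ b∈ a≢b _ _ _ =
  ⊥-elim (a≢b (trans (range-single a∈) (sym (range-single b∈))))
pairMax-≥2-distinct (suc (suc len)) lo c a∈ b∈ a≢b unpaired ca cb with range-split a∈ | range-split b∈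
... | inj₁ a-end | inj₁ b-end = ⊥-elim (unpaired (ends-paired a-end b-end a≢b))
... | inj₁ a-end | inj₂ b∈′   =
  +-mono-≤ (≤-trans ca (end≤⊔ c {lo} {len} a-end)) (pairMax-≥1 len (suc lo) c b∈′ cb)
... | inj₂ a∈′   | inj₁ b-end =
  +-mono-≤ (≤-trans cb (end≤⊔ c {lo} {len} b-end)) (pairMax-≥1 len (suc lo) c a∈′ ca)
... | inj₂ a∈′   | inj₂ b∈′   = ≤-trans (pairMax-≥2-distinct len (suc lo) c a∈′ b∈′ a≢b
                                         (unpaired ∘ shift-pair-sum lo len) ca cb) (m≤n+m _ _)

∣suc[n]-n∣≡1 : ∀ n → ∣ suc n - n ∣ ≡ 1
∣suc[n]-n∣≡1 zero    = refl
∣suc[n]-n∣≡1 (suc n) = ∣suc[n]-n∣≡1 n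

pairDefect-crossing : ∀ c lo len {v} → c lo ≡ suc v → c (lo + suc len) ≡ v →
                      pairDefect c lo (2 + len) ≡ suc (pairDefect c (suc lo) len)
pairDefect-crossing c lo len {v} lo≡ hi≡ rewrite lo≡ | hi≡ = cong (_+ _) (∣suc[n]-n∣≡1 v)

2*m≤1+2*n⇒m≤n : ∀ m n → 2 * m ≤ suc (2 * n) → m ≤ n
2*m≤1+2*n⇒m≤n zero    n       _  = z≤n
2*m≤1+2*n⇒m≤n (suc m) zero    le rewrite +-suc m (m + 0) = ⊥-elim (<-irrefl refl (≤-trans (s≤s (s≤s z≤n)) le))
2*m≤1+2*n⇒m≤n (suc m) (suc n) le rewrite *-suc 2 m | *-suc 2 n =
  s≤s (2*m≤1+2*n⇒m≤n m n (≤-pred (≤-pred le)))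

-- Class sizes of the board 1, …, q D + ρ (with ρ < D): class 0 holds q numbers,
-- the classes 1, …, ρ hold q + 1 and the others q.
boardProfile : ℕ → ℕ → ℕ → ℕ
boardProfile q ρ zero    = q
boardProfile q ρ (suc r) = q + 𝟙[ r < ρ ]

boardProfile-suc : ∀ q ρ r → boardProfile q (suc ρ) r ≡ boardProfile q ρ r + δ (suc ρ) r
boardProfile-suc q ρ zero    = sym (+-identityʳ q)
boardProfile-suc q ρ (suc r) = trans (cong (q +_) (𝟙<-suc r ρ)) (sym (+-assoc q _ _))

boardProfile-wrap : ∀ q {d′ r} → r < suc d′ → boardProfile (suc q) 0 r ≡ boardProfile q d′ r + δ 0 r
boardProfile-wrap q {r = zero}  _   = sym (+-comm q 1)
boardProfile-wrap q {r = suc r} r<D rewrite 𝟙<-yes (≤-pred r<D) = sym (cong (_+ 0) (+-comm q 1))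

boardProfile-below : ∀ {q ρ r} → 1 ≤ r → r ≤ ρ → boardProfile q ρ r ≡ suc q
boardProfile-below {q} {r = suc r} _ r≤ρ rewrite 𝟙<-yes r≤ρ = +-comm q 1

boardProfile-above : ∀ {q ρ r} → ρ < r → boardProfile q ρ r ≡ q
boardProfile-above {q} {r = suc r} ρ<r rewrite 𝟙<-no (≤-pred ρ<r) = +-identityʳ q

-- In this lemma and the next, the j outermost pairs straddle ρ and inside them the profile is constant.
pairDefect-boardProfile-low : ∀ j q ρ lo len → 1 ≤ lo → lo + j ≡ suc ρ →
  pairDefect (boardProfile q ρ) lo (j * 2 + len) ≡ j + pairDefect (λ _ → q) (j + lo) len
pairDefect-boardProfile-low zero q ρ lo len _ lo≡ =
  pairFold-cong len lo λ r∈ →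
    boardProfile-above (≤-trans (≤-reflexive (trans (sym lo≡) (+-identityʳ lo))) (proj₁ r∈))
pairDefect-boardProfile-low (suc j) q ρ lo len 1≤lo lo≡ = begin
  pairDefect P lo (2 + (j * 2 + len))
    ≡⟨ pairDefect-crossing P lo (j * 2 + len) (boardProfile-below 1≤lo lo≤ρ) (boardProfile-above ρ<hi) ⟩
  suc (pairDefect P (suc lo) (j * 2 + len))
    ≡⟨ cong suc (pairDefect-boardProfile-low j q ρ (suc lo) len (s≤s z≤n) (trans (sym (+-suc lo j)) lo≡)) ⟩
  suc (j + pairDefect (λ _ → q) (j + suc lo) len)
    ≡⟨ cong (λ l → suc (j + pairDefect (λ _ → q) l len)) (+-suc j lo) ⟩
  suc j + pairDefect (λ _ → q) (suc j + lo) len ∎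
  where
  open ≡-Reasoning
  P = boardProfile q ρ
  lo+j≡ρ : lo + j ≡ ρ
  lo+j≡ρ = suc-injective (trans (sym (+-suc lo j)) lo≡)
  lo≤ρ : lo ≤ ρ
  lo≤ρ = subst (lo ≤_) lo+j≡ρ (m≤m+n lo j)
  ρ<hi : ρ < lo + suc (j * 2 + len)
  ρ<hi = subst (_< lo + suc (j * 2 + len)) lo+j≡ρ
           (+-monoʳ-< lo (s≤s (≤-trans (m≤m*n j 2) (m≤m+n (j * 2) len))))

pairDefect-boardProfile-high : ∀ j q ρ lo len → 1 ≤ lo → lo + j + len ≡ suc ρ →
  pairDefect (boardProfile q ρ) lo (j * 2 + len) ≡ j + pairDefect (λ _ → suc q) (j + lo) len
pairDefect-boardProfile-high zero q ρ lo len 1≤lo top≡ =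
  pairFold-cong len lo (λ {r} r∈ → boardProfile-below (≤-trans 1≤lo (proj₁ r∈))
    (≤-pred (subst (r <_) (trans (cong (_+ len) (sym (+-identityʳ lo))) top≡) (proj₂ r∈))))
pairDefect-boardProfile-high (suc j) q ρ lo len 1≤lo top≡ = begin
  pairDefect P lo (2 + (j * 2 + len))
    ≡⟨ pairDefect-crossing P lo (j * 2 + len) (boardProfile-below 1≤lo lo≤ρ) (boardProfile-above ρ<hi) ⟩
  suc (pairDefect P (suc lo) (j * 2 + len))
    ≡⟨ cong suc (pairDefect-boardProfile-high j q ρ (suc lo) len (s≤s z≤n)
                  (trans (cong (_+ len) (sym (+-suc lo j))) top≡)) ⟩
  suc (j + pairDefect (λ _ → suc q) (j + suc lo) len)
    ≡⟨ cong (λ l → suc (j + pairDefect (λ _ → suc q) l len)) (+-suc j lo) ⟩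
  suc j + pairDefect (λ _ → suc q) (suc j + lo) len ∎
  where
  open ≡-Reasoning
  P = boardProfile q ρ
  ρ≡ : lo + j + len ≡ ρ
  ρ≡ = suc-injective (trans (cong (_+ len) (sym (+-suc lo j))) top≡)
  lo≤ρ : lo ≤ ρ
  lo≤ρ = subst (lo ≤_) (trans (sym (+-assoc lo j len)) ρ≡) (m≤m+n lo (j + len))
  ρ<hi : ρ < lo + suc (j * 2 + len)
  ρ<hi = subst (_< lo + suc (j * 2 + len)) (trans (sym (+-assoc lo j len)) ρ≡)
           (+-monoʳ-< lo (s≤s (+-monoˡ-≤ len (m≤m*n j 2))))

module Residues (d′ : ℕ) where

  D : ℕ
  D = suc d′

  -- The α of the proof idea, computed from the class sizes c of a board.
  independence : (ℕ → ℕ) → ℕ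
  independence c = sgn (c 0) + pairMax c 1 d′

  total : (ℕ → ℕ) → ℕ
  total c = c 0 + classSum c 1 d′

  independence-mono : ∀ {c c′ : ℕ → ℕ} → (∀ r → c′ r ≤ c r) → independence c′ ≤ independence c
  independence-mono le = +-mono-≤ (sgn-mono (le 0)) (pairMax-mono d′ 1 le)

  classes-cong : ∀ {c c′ : ℕ → ℕ} → (∀ {r} → r < D → c′ r ≡ c r) →
                 independence c′ ≡ independence c × total c′ ≡ total c
  classes-cong eq = cong₂ _+_ (cong sgn (eq (s≤s z≤n))) (pairFold-cong d′ 1 (eq ∘ proj₂)) ,
                    cong₂ _+_ (eq (s≤s z≤n)) (pairFold-cong d′ 1 (eq ∘ proj₂))

  total-+ : ∀ {c e f : ℕ → ℕ} → (∀ r → c r ≡ e r + f r) → total c ≡ total e + total f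
  total-+ {c} {e} {f} eq = begin
    c 0 + classSum c 1 d′                            ≡⟨ cong₂ _+_ (eq 0) (classSum-+ d′ 1 eq) ⟩
    (e 0 + f 0) + (classSum e 1 d′ + classSum f 1 d′) ≡⟨ shuffle (e 0) (f 0) _ _ ⟩
    total e + total f                                ∎
    where
    open ≡-Reasoning
    shuffle : ∀ a b s t → (a + b) + (s + t) ≡ (a + s) + (b + t)
    shuffle = solve-∀

  0≢positive : ∀ {r} → InRange 1 d′ r → 0 ≢ r
  0≢positive r∈ 0≡r = <-irrefl 0≡r (proj₁ r∈)

  total-δ : ∀ {a} → a < D → total (δ a) ≡ 1
  total-δ {zero}  _   = cong suc (classSum-vanishing d′ 1 (δ-diff ∘ 0≢positive))
  total-δ {suc a} a<D = classSum-δ d′ 1 (s≤s z≤n , a<D)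

  independence-reducible-or-balanced : ∀ c → Reducible (_< D) independence c ⊎ 2 * independence c ≤ total c
  independence-reducible-or-balanced c = by-class-0 (c 0) refl
    where
    from-pairs : 2 * sgn (c 0) ≤ c 0 → Reducible (_< D) independence c ⊎ 2 * independence c ≤ total c
    from-pairs zero-balanced with pairMax-reducible-or-balanced d′ 1 c
    ... | inj₂ balanced = inj₂ (subst (_≤ total c) (sym (*-distribˡ-+ 2 (sgn (c 0)) _))
                                      (+-mono-≤ zero-balanced balanced))
    ... | inj₁ (reducible a (1≤a , a<D) occupied reduces) = inj₁ (reducible a a<D occupied lower)
      where
      lower : ∀ {c′} → Removal a c′ c → independence c′ < independence c
      lower rem rewrite removal-other rem (λ a≡0 → <-irrefl (sym a≡0) 1≤a) =
        subst (_≤ independence c) (+-suc (sgn (c 0)) _) (+-monoʳ-≤ (sgn (c 0)) (reduces rem))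
    by-class-0 : ∀ v → c 0 ≡ v → Reducible (_< D) independence c ⊎ 2 * independence c ≤ total c
    by-class-0 zero          eq = from-pairs (subst (λ v → 2 * sgn v ≤ v) (sym eq) z≤n)
    by-class-0 (suc (suc _)) eq = from-pairs (subst (λ v → 2 * sgn v ≤ v) (sym eq) (s≤s (s≤s z≤n)))
    by-class-0 (suc zero)    eq = inj₁ (reducible 0 (s≤s z≤n) (≤-reflexive (sym eq)) lower)
      where
      lower : ∀ {c′} → Removal 0 c′ c → independence c′ < independence c
      lower rem rewrite eq | suc-injective (trans (removal-self rem) eq)
        | pairFold-cong {sgn} {_⊔_} d′ 1 (removal-other rem ∘ 0≢positive) = ≤-refl

  classSize : List ℕ → ℕ → ℕ
  classSize []       r = 0
  classSize (x ∷ xs) r = δ (x % D) r + classSize xs r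

  total-classSize : ∀ b → total (classSize b) ≡ length b
  total-classSize []       = classSum-const0 d′ 1
  total-classSize (x ∷ xs) =
    trans (total-+ {e = δ (x % D)} {f = classSize xs} (λ _ → refl))
          (cong₂ _+_ (total-δ (m%n<n x D)) (total-classSize xs))

  classSize-removeAt : ∀ b i → Removal (lookup b i % D) (classSize (removeAt b i)) (classSize b)
  classSize-removeAt (x ∷ xs) zero    r = refl
  classSize-removeAt (x ∷ xs) (suc i) r = begin
    δ (lookup xs i % D) r + (δ (x % D) r + classSize (removeAt xs i) r)
      ≡⟨ x+[y+z]≡y+[x+z] (δ (lookup xs i % D) r) (δ (x % D) r) _ ⟩
    δ (x % D) r + (δ (lookup xs i % D) r + classSize (removeAt xs i) r)
      ≡⟨ cong (δ (x % D) r +_) (classSize-removeAt xs i r) ⟩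
    δ (x % D) r + classSize xs r ∎
    where
    open ≡-Reasoning
    x+[y+z]≡y+[x+z] : ∀ a b c → a + (b + c) ≡ b + (a + c)
    x+[y+z]≡y+[x+z] = solve-∀

  member-of-class : ∀ b {a} → 1 ≤ classSize b a → Σ[ i ∈ Fin (length b) ] lookup b i % D ≡ a
  member-of-class (x ∷ xs) {a} occupied with x % D ≟ a
  ... | yes x≡a = zero , x≡a
  ... | no  x≢a with member-of-class xs (subst (λ v → 1 ≤ v + classSize xs a) (δ-diff x≢a) occupied)
  ...   | i , xi≡a = suc i , xi≡a

  independence-removeAt : ∀ b i → independence (classSize (removeAt b i)) ≤ independence (classSize b)
  independence-removeAt b i = independence-mono (removal-≤ {lookup b i % D} (classSize-removeAt b i))

  divisible-by-residues : ∀ x y → (x % D + y % D) % D ≡ 0 → D ∣ x + y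
  divisible-by-residues x y eq = m%n≡0⇒n∣m (x + y) D (trans (%-distribˡ-+ x y D) eq)

  first-occupies : ∀ x y → 1 ≤ classSize (x ∷ y ∷ []) (x % D)
  first-occupies x y rewrite δ-same (x % D) = s≤s z≤n

  second-occupies : ∀ x y → 1 ≤ classSize (x ∷ y ∷ []) (y % D)
  second-occupies x y rewrite δ-same (y % D) = m≤n+m 1 (δ (x % D) (y % D))

  pair-independence : ∀ x y → D ∣ x + y ⊎ 2 ≤ independence (classSize (x ∷ y ∷ []))
  pair-independence x y with x % D ≟ 0 | y % D ≟ 0
  ... | yes x≡0 | yes y≡0 = inj₁ (divisible-by-residues x y (cong (_% D) (cong₂ _+_ x≡0 y≡0)))
  ... | yes x≡0 | no  y≢0 = inj₂ (+-mono-≤ (sgn-mono (subst (λ r → 1 ≤ c r) x≡0 (first-occupies x y)))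
                                           (pairMax-≥1 d′ 1 c (n≢0⇒n>0 y≢0 , m%n<n y D) (second-occupies x y)))
    where c = classSize (x ∷ y ∷ [])
  ... | no  x≢0 | yes y≡0 = inj₂ (+-mono-≤ (sgn-mono (subst (λ r → 1 ≤ c r) y≡0 (second-occupies x y)))
                                           (pairMax-≥1 d′ 1 c (n≢0⇒n>0 x≢0 , m%n<n x D) (first-occupies x y)))
    where c = classSize (x ∷ y ∷ [])
  ... | no  x≢0 | no  y≢0 with x % D + y % D ≟ D | x % D ≟ y % D
  ...   | yes sum≡D | _ = inj₁ (divisible-by-residues x y (trans (cong (_% D) sum≡D) (n%n≡0 D)))
  ...   | no  sum≢D | yes x≡y = inj₂ (≤-trans (pairMax-≥2-repeated d′ 1 c (n≢0⇒n>0 x≢0 , m%n<n x D)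
                                                 (sum≢D ∘ trans (cong (x % D +_) (sym x≡y)) ∘ suc-injective) twice)
                                              (m≤n+m _ _))
    where
    c = classSize (x ∷ y ∷ [])
    twice : 2 ≤ c (x % D)
    twice rewrite δ-same (x % D) | sym x≡y | δ-same (x % D) = ≤-refl
  ...   | no  sum≢D | no  x≢y = inj₂ (≤-trans (pairMax-≥2-distinct d′ 1 c (n≢0⇒n>0 x≢0 , m%n<n x D)
                                                 (n≢0⇒n>0 y≢0 , m%n<n y D) x≢y (sum≢D ∘ suc-injective)
                                                 (first-occupies x y) (second-occupies x y))
                                              (m≤n+m _ _))
    where c = classSize (x ∷ y ∷ [])

  last-pair-divisible : ∀ x y → 2 * independence (classSize (x ∷ y ∷ [])) ≤ 2 → D ∣ x + y
  last-pair-divisible x y bound with pair-independence x y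
  ... | inj₁ divisible = divisible
  ... | inj₂ 2≤ind = ⊥-elim (<⇒≱ (s≤s (s≤s (s≤s z≤n))) (≤-trans (*-monoʳ-≤ 2 2≤ind) bound))

  length-removeAt-suc : ∀ (b : List ℕ) i {k} → length b ≡ suc k → length (removeAt b i) ≡ k
  length-removeAt-suc b i eq = trans (length-removeAt b i) (cong pred eq)

  after-reducing-move : ∀ {x y} m → suc x ≤ y → 2 * y ≤ (3 + 2 * m) + 1 → 2 * x ≤ 2 + 2 * m
  after-reducing-move {x} {y} m lt le = +-cancelˡ-≤ 2 _ _ (begin
    2 + 2 * x     ≡⟨ *-suc 2 x ⟨
    2 * suc x     ≤⟨ *-monoʳ-≤ 2 lt ⟩
    2 * y         ≤⟨ le ⟩
    3 + 2 * m + 1 ≡⟨ +-comm (3 + 2 * m) 1 ⟩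
    4 + 2 * m     ∎)
    where open ≤-Reasoning

  after-balanced-move : ∀ y m → 2 * y ≤ 3 + 2 * m → 2 * y ≤ 2 + 2 * m
  after-balanced-move y m le = subst (2 * y ≤_) (*-suc 2 m)
    (*-monoʳ-≤ 2 (2*m≤1+2*n⇒m≤n y (suc m) (subst (λ k → 2 * y ≤ suc k) (sym (*-suc 2 m)) le)))

  three≤ : ∀ (b : List ℕ) {k} → length b ≡ 3 + k → 3 ≤ length b
  three≤ b len≡ = subst (3 ≤_) (sym len≡) (m≤m+n 3 _)

  mutual
    A-forces : ∀ m b → length b ≡ 3 + 2 * m → 2 * independence (classSize b) ≤ length b + 1 → AForces D A b
    A-forces m b len≡ bound with independence-reducible-or-balanced (classSize b)
    ... | inj₁ (reducible a _ occupied reduces) with member-of-class b occupied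
    ...   | i , class≡a = moveA (three≤ b len≡) i
            (B-forces m (removeAt b i) len′≡ (subst (2 * α′ ≤_) (sym len′≡) bound′))
      where
      len′≡ = length-removeAt-suc b i len≡
      α′ = independence (classSize (removeAt b i))
      bound′ : 2 * α′ ≤ 2 + 2 * m
      bound′ = after-reducing-move m
        (reduces (subst (λ a → Removal a (classSize (removeAt b i)) (classSize b)) class≡a (classSize-removeAt b i)))
        (subst (λ k → 2 * independence (classSize b) ≤ k + 1) len≡ bound)
    A-forces m b@(_ ∷ _) len≡ bound | inj₂ balanced = moveA (three≤ b len≡) zero
            (B-forces m (removeAt b zero) len′≡ (subst (2 * α′ ≤_) (sym len′≡) bound′))
      where
      len′≡ = suc-injective len≡
      α′ = independence (classSize (removeAt b zero))
      bound′ : 2 * α′ ≤ 2 + 2 * m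
      bound′ = ≤-trans (*-monoʳ-≤ 2 (independence-removeAt b zero))
        (after-balanced-move (independence (classSize b)) m
          (subst (2 * independence (classSize b) ≤_) (trans (total-classSize b) len≡) balanced))

    B-forces : ∀ m b → length b ≡ 2 + 2 * m → 2 * independence (classSize b) ≤ length b → AForces D B b
    B-forces zero    (x ∷ y ∷ []) _ bound = done (last-pair-divisible x y bound)
    B-forces (suc m) b len≡ bound = moveB (three≤ b len≡′) λ i →
      A-forces m (removeAt b i) (length-removeAt-suc b i len≡′)
        (≤-trans (*-monoʳ-≤ 2 (independence-removeAt b i))
          (subst (2 * independence (classSize b) ≤_) (trans (length-removeAt′ b i) (+-comm 1 _)) bound))
      where
      len≡′ : length b ≡ 3 + suc (2 * m)
      len≡′ = trans len≡ (cong (2 +_) (*-suc 2 m))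

  residue : ∀ q {ρ} → ρ < D → (q * D + ρ) % D ≡ ρ
  residue q {ρ} ρ<D = trans (cong (_% D) (+-comm (q * D) ρ)) (trans ([m+kn]%n≡m%n ρ q D) (m<n⇒m%n≡m ρ<D))

  classSize-++ : ∀ xs ys r → classSize (xs ++ ys) r ≡ classSize xs r + classSize ys r
  classSize-++ []       ys r = refl
  classSize-++ (x ∷ xs) ys r = trans (cong (δ (x % D) r +_) (classSize-++ xs ys r))
                                     (sym (+-assoc (δ (x % D) r) (classSize xs r) (classSize ys r)))

  classSize-board-suc : ∀ n r → classSize (board (suc n)) r ≡ classSize (board n) r + δ (suc n % D) r
  classSize-board-suc n r = begin
    classSize (board (suc n)) r                 ≡⟨ cong (λ b → classSize b r) board-snoc ⟩
    classSize (board n ++ [ suc n ]) r          ≡⟨ classSize-++ (board n) [ suc n ] r ⟩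
    classSize (board n) r + (δ (suc n % D) r + 0) ≡⟨ cong (classSize (board n) r +_) (+-identityʳ _) ⟩
    classSize (board n) r + δ (suc n % D) r     ∎
    where
    open ≡-Reasoning
    board-snoc : board (suc n) ≡ board n ++ [ suc n ]
    board-snoc = trans (cong (map suc) (sym (upTo-∷ʳ n))) (map-++ suc (upTo n) [ n ])

  classSize-board : ∀ q ρ → ρ < D → ∀ {r} → r < D → classSize (board (q * D + ρ)) r ≡ boardProfile q ρ r
  classSize-board zero    zero    _ {zero}  _ = refl
  classSize-board zero    zero    _ {suc r} _ = refl
  classSize-board q       (suc ρ) ρ<D {r} r<D = begin
    classSize (board (q * D + suc ρ)) r
      ≡⟨ cong (λ n → classSize (board n) r) (+-suc (q * D) ρ) ⟩
    classSize (board (suc (q * D + ρ))) r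
      ≡⟨ classSize-board-suc (q * D + ρ) r ⟩
    classSize (board (q * D + ρ)) r + δ (suc (q * D + ρ) % D) r
      ≡⟨ cong₂ _+_ (classSize-board q ρ (<-trans (n<1+n ρ) ρ<D) r<D)
                   (cong (λ x → δ x r) (trans (cong (_% D) (sym (+-suc (q * D) ρ))) (residue q ρ<D))) ⟩
    boardProfile q ρ r + δ (suc ρ) r
      ≡⟨ boardProfile-suc q ρ r ⟨
    boardProfile q (suc ρ) r ∎
    where open ≡-Reasoning
  classSize-board (suc q) zero    _ {r} r<D = begin
    classSize (board (suc q * D + 0)) r
      ≡⟨ cong (λ n → classSize (board n) r) last ⟩
    classSize (board (suc (q * D + d′))) r
      ≡⟨ classSize-board-suc (q * D + d′) r ⟩
    classSize (board (q * D + d′)) r + δ (suc (q * D + d′) % D) r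
      ≡⟨ cong₂ _+_ (classSize-board q d′ ≤-refl r<D)
                   (cong (λ x → δ x r) (trans (cong (_% D) (sym last)) (residue (suc q) (s≤s z≤n)))) ⟩
    boardProfile q d′ r + δ 0 r
      ≡⟨ boardProfile-wrap q r<D ⟨
    boardProfile (suc q) 0 r ∎
    where
    open ≡-Reasoning
    last : suc q * D + 0 ≡ suc (q * D + d′)
    last = cong suc (trans (+-identityʳ _) (+-comm d′ (q * D)))

  odd-board-wins : ∀ {n} q ρ m {e} → ρ < D → n ≡ q * D + ρ → q * D + ρ ≡ 3 + 2 * m →
                   pairDefect (boardProfile q ρ) 1 d′ ≡ e → 2 * sgn q + e ≤ suc q → AWinsZ n D
  odd-board-wins {n} q ρ m {e} ρ<D n≡qD+ρ odd defect≡ defect-bound =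
    A-forces m (board n) (trans (length-board n) (trans n≡qD+ρ odd)) (begin
      2 * independence (classSize (board n))      ≡⟨ cong (2 *_) (proj₁ (classes-cong counts)) ⟩
      2 * (sgn q + pairMax P 1 d′)                ≡⟨ *-distribˡ-+ 2 (sgn q) _ ⟩
      2 * sgn q + 2 * pairMax P 1 d′              ≤⟨ +-monoʳ-≤ (2 * sgn q) (pairMax-bound d′ 1 P) ⟩
      2 * sgn q + (classSum P 1 d′ + pairDefect P 1 d′) ≡⟨ shuffle (2 * sgn q) _ _ ⟩
      (2 * sgn q + pairDefect P 1 d′) + classSum P 1 d′
                                                  ≡⟨ cong (λ e → 2 * sgn q + e + classSum P 1 d′) defect≡ ⟩
      (2 * sgn q + e) + classSum P 1 d′           ≤⟨ +-monoˡ-≤ _ defect-bound ⟩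
      suc q + classSum P 1 d′                     ≡⟨ +-comm 1 (total P) ⟩
      total P + 1                                 ≡⟨ cong (_+ 1) (sym (proj₂ (classes-cong counts))) ⟩
      total (classSize (board n)) + 1             ≡⟨ cong (_+ 1) (total-classSize (board n)) ⟩
      length (board n) + 1                        ∎)
    where
    open ≤-Reasoning
    P = boardProfile q ρ
    counts : ∀ {r} → r < D → classSize (board n) r ≡ P r
    counts r<D = subst (λ k → classSize (board k) _ ≡ _) (sym n≡qD+ρ) (classSize-board q ρ ρ<D r<D)
    length-board : ∀ n → length (board n) ≡ n
    length-board n = trans (length-map suc (upTo n)) (length-upTo n)
    shuffle : ∀ a t e → a + (t + e) ≡ (a + e) + t
    shuffle = solve-∀

m≡n+o⇒m∸n≡o : ∀ {m} n o → m ≡ n + o → m ∸ n ≡ o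
m≡n+o⇒m∸n≡o n o refl = m+n∸m≡n n o

2*suc[n]∸1≡suc[2*n] : ∀ n → 2 * suc n ∸ 1 ≡ suc (2 * n)
2*suc[n]∸1≡suc[2*n] n = +-suc n (n + 0)

-- In both modulus modules, k is one less than the k of the statement.
module EvenModulus (h : ℕ) where
  open Residues (7 + h * 2)

  kd∸1 : ∀ k n → n ≡ suc k * D ∸ 1 → AWinsZ n D
  kd∸1 k n n≡ = odd-board-wins k (7 + h * 2) (2 + h + k * (4 + h)) ≤-refl
    (trans n≡ (m≡n+o⇒m∸n≡o 1 _ (position h k))) (odd h k)
    (trans (pairDefect-boardProfile-high 0 k (7 + h * 2) 1 (7 + h * 2) (s≤s z≤n) refl)
           (pairDefect-const-odd (3 + h) 1 (suc k)))
    (bound k)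
    where
    position : ∀ h k → suc k * (8 + h * 2) ≡ 1 + (k * (8 + h * 2) + (7 + h * 2))
    position = solve-∀
    odd : ∀ h k → k * (8 + h * 2) + (7 + h * 2) ≡ 3 + 2 * (2 + h + k * (4 + h))
    odd = solve-∀
    bound : ∀ k → 2 * sgn k + δ k 0 ≤ suc k
    bound zero    = ≤-refl
    bound (suc _) = s≤s (s≤s z≤n)

  [k+1]d+1 : ∀ k n → n ≡ (suc k + 1) * D + 1 → AWinsZ n D
  [k+1]d+1 k n n≡ = odd-board-wins (2 + k) 1 (7 + h * 2 + k * (4 + h)) (s≤s (s≤s z≤n))
    (trans n≡ (cong (λ q → q * D + 1) (+-comm (suc k) 1))) (odd h k)
    (trans (pairDefect-boardProfile-low 1 (2 + k) 1 1 (5 + h * 2) (s≤s z≤n) refl)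
           (cong (1 +_) (pairDefect-const-odd (2 + h) 2 (2 + k))))
    (m≤m+n 3 k)
    where
    odd : ∀ h k → (2 + k) * (8 + h * 2) + 1 ≡ 3 + 2 * (7 + h * 2 + k * (4 + h))
    odd = solve-∀

  [k+3]d∸3 : ∀ k n → n ≡ (suc k + 3) * D ∸ 3 → AWinsZ n D
  [k+3]d∸3 k n n≡ = odd-board-wins (3 + k) (5 + h * 2) (13 + h * 4 + k * (4 + h)) (m≤n+m (6 + h * 2) 2)
    (trans n≡ (m≡n+o⇒m∸n≡o 3 _ (position h k))) (odd h k)
    (trans (pairDefect-boardProfile-high 2 (3 + k) (5 + h * 2) 1 (3 + h * 2) (s≤s z≤n) refl)
           (cong (2 +_) (pairDefect-const-odd (1 + h) 3 (4 + k))))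
    (m≤m+n 4 k)
    where
    position : ∀ h k → (suc k + 3) * (8 + h * 2) ≡ 3 + ((3 + k) * (8 + h * 2) + (5 + h * 2))
    position = solve-∀
    odd : ∀ h k → (3 + k) * (8 + h * 2) + (5 + h * 2) ≡ 3 + 2 * (13 + h * 4 + k * (4 + h))
    odd = solve-∀

  wins : ∀ k n → (n ≡ suc k * D ∸ 1) ⊎ (n ≡ (suc k + 1) * D + 1) ⊎ (n ≡ (suc k + 3) * D ∸ 3) → AWinsZ n D
  wins k n (inj₁ n≡)        = kd∸1 k n n≡
  wins k n (inj₂ (inj₁ n≡)) = [k+1]d+1 k n n≡
  wins k n (inj₂ (inj₂ n≡)) = [k+3]d∸3 k n n≡

module OddModulus (g : ℕ) where
  open Residues (6 + g * 2)

  [2k-1]d∸2 : ∀ k n → n ≡ (2 * suc k ∸ 1) * D ∸ 2 → AWinsZ n D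
  [2k-1]d∸2 k n n≡ = odd-board-wins (2 * k) (5 + g * 2) (1 + g + k * (7 + g * 2)) (n≤1+n _)
    (trans n≡ (trans (cong (λ q → q * D ∸ 2) (2*suc[n]∸1≡suc[2*n] k)) (m≡n+o⇒m∸n≡o 2 _ (position g k))))
    (odd g k)
    (trans (pairDefect-boardProfile-high 1 (2 * k) (5 + g * 2) 1 (4 + g * 2) (s≤s z≤n) refl)
           (cong (1 +_) (pairDefect-const-even (2 + g) 2 (suc (2 * k)))))
    (bound k)
    where
    position : ∀ g k → suc (2 * k) * (7 + g * 2) ≡ 2 + (2 * k * (7 + g * 2) + (5 + g * 2))
    position = solve-∀
    odd : ∀ g k → 2 * k * (7 + g * 2) + (5 + g * 2) ≡ 3 + 2 * (1 + g + k * (7 + g * 2))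
    odd = solve-∀
    bound : ∀ k → 2 * sgn (2 * k) + 1 ≤ suc (2 * k)
    bound zero    = ≤-refl
    bound (suc k) = s≤s (s≤s (subst (1 ≤_) (sym (+-suc k (k + 0))) (s≤s z≤n)))

  [2k-1]d : ∀ k n → n ≡ (2 * suc k ∸ 1) * D → AWinsZ n D
  [2k-1]d k n n≡ = odd-board-wins (suc (2 * k)) 0 (2 + g + k * (7 + g * 2)) (s≤s z≤n)
    (trans n≡ (trans (cong (_* D) (2*suc[n]∸1≡suc[2*n] k)) (sym (+-identityʳ _))))
    (odd g k)
    (trans (pairDefect-boardProfile-low 0 (suc (2 * k)) 0 1 (6 + g * 2) (s≤s z≤n) refl)
           (pairDefect-const-even (3 + g) 1 (suc (2 * k))))
    (s≤s (s≤s z≤n))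
    where
    odd : ∀ g k → suc (2 * k) * (7 + g * 2) + 0 ≡ 3 + 2 * (2 + g + k * (7 + g * 2))
    odd = solve-∀

  2kd∸1 : ∀ k n → n ≡ 2 * suc k * D ∸ 1 → AWinsZ n D
  2kd∸1 k n n≡ = odd-board-wins (suc (2 * k)) (6 + g * 2) (5 + g * 2 + k * (7 + g * 2)) ≤-refl
    (trans n≡ (m≡n+o⇒m∸n≡o 1 _ (position g k)))
    (odd g k)
    (trans (pairDefect-boardProfile-high 0 (suc (2 * k)) (6 + g * 2) 1 (6 + g * 2) (s≤s z≤n) refl)
           (pairDefect-const-even (3 + g) 1 (2 + 2 * k)))
    (s≤s (s≤s z≤n))
    where
    position : ∀ g k → 2 * suc k * (7 + g * 2) ≡ 1 + (suc (2 * k) * (7 + g * 2) + (6 + g * 2))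
    position = solve-∀
    odd : ∀ g k → suc (2 * k) * (7 + g * 2) + (6 + g * 2) ≡ 3 + 2 * (5 + g * 2 + k * (7 + g * 2))
    odd = solve-∀

  2kd+1 : ∀ k n → n ≡ 2 * suc k * D + 1 → AWinsZ n D
  2kd+1 k n n≡ = odd-board-wins (2 + 2 * k) 1 (6 + g * 2 + k * (7 + g * 2)) (s≤s (s≤s z≤n))
    (trans n≡ (position g k))
    (odd g k)
    (trans (pairDefect-boardProfile-low 1 (2 + 2 * k) 1 1 (4 + g * 2) (s≤s z≤n) refl)
           (cong (1 +_) (pairDefect-const-even (2 + g) 2 (2 + 2 * k))))
    (m≤m+n 3 (2 * k))
    where
    position : ∀ g k → 2 * suc k * (7 + g * 2) + 1 ≡ (2 + 2 * k) * (7 + g * 2) + 1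
    position = solve-∀
    odd : ∀ g k → (2 + 2 * k) * (7 + g * 2) + 1 ≡ 3 + 2 * (6 + g * 2 + k * (7 + g * 2))
    odd = solve-∀

  [2k+1]d+2 : ∀ k n → n ≡ (2 * suc k + 1) * D + 2 → AWinsZ n D
  [2k+1]d+2 k n n≡ = odd-board-wins (3 + 2 * k) 2 (10 + g * 3 + k * (7 + g * 2)) (s≤s (s≤s (s≤s z≤n)))
    (trans n≡ (position g k))
    (odd g k)
    (trans (pairDefect-boardProfile-low 2 (3 + 2 * k) 2 1 (2 + g * 2) (s≤s z≤n) refl)
           (cong (2 +_) (pairDefect-const-even (1 + g) 3 (3 + 2 * k))))
    (m≤m+n 4 (2 * k))
    where
    position : ∀ g k → (2 * suc k + 1) * (7 + g * 2) + 2 ≡ (3 + 2 * k) * (7 + g * 2) + 2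
    position = solve-∀
    odd : ∀ g k → (3 + 2 * k) * (7 + g * 2) + 2 ≡ 3 + 2 * (10 + g * 3 + k * (7 + g * 2))
    odd = solve-∀

  2[k+1]d∸3 : ∀ k n → n ≡ 2 * (suc k + 1) * D ∸ 3 → AWinsZ n D
  2[k+1]d∸3 k n n≡ = odd-board-wins (3 + 2 * k) (4 + g * 2) (11 + g * 4 + k * (7 + g * 2)) (m≤n+m (5 + g * 2) 2)
    (trans n≡ (m≡n+o⇒m∸n≡o 3 _ (position g k)))
    (odd g k)
    (trans (pairDefect-boardProfile-high 2 (3 + 2 * k) (4 + g * 2) 1 (2 + g * 2) (s≤s z≤n) refl)
           (cong (2 +_) (pairDefect-const-even (1 + g) 3 (4 + 2 * k))))
    (m≤m+n 4 (2 * k))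
    where
    position : ∀ g k → 2 * (suc k + 1) * (7 + g * 2) ≡ 3 + ((3 + 2 * k) * (7 + g * 2) + (4 + g * 2))
    position = solve-∀
    odd : ∀ g k → (3 + 2 * k) * (7 + g * 2) + (4 + g * 2) ≡ 3 + 2 * (11 + g * 4 + k * (7 + g * 2))
    odd = solve-∀

  wins : ∀ k n →
    (n ≡ (2 * suc k ∸ 1) * D ∸ 2) ⊎ (n ≡ (2 * suc k ∸ 1) * D) ⊎ (n ≡ 2 * suc k * D ∸ 1) ⊎
    (n ≡ 2 * suc k * D + 1) ⊎ (n ≡ (2 * suc k + 1) * D + 2) ⊎ (n ≡ 2 * (suc k + 1) * D ∸ 3) → AWinsZ n D
  wins k n (inj₁ n≡)                             = [2k-1]d∸2 k n n≡
  wins k n (inj₂ (inj₁ n≡))                      = [2k-1]d k n n≡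
  wins k n (inj₂ (inj₂ (inj₁ n≡)))               = 2kd∸1 k n n≡
  wins k n (inj₂ (inj₂ (inj₂ (inj₁ n≡))))        = 2kd+1 k n n≡
  wins k n (inj₂ (inj₂ (inj₂ (inj₂ (inj₁ n≡))))) = [2k+1]d+2 k n n≡
  wins k n (inj₂ (inj₂ (inj₂ (inj₂ (inj₂ n≡))))) = 2[k+1]d∸3 k n n≡

parity : ∀ n → (Σ[ g ∈ ℕ ] n ≡ g * 2) ⊎ (Σ[ g ∈ ℕ ] n ≡ suc (g * 2))
parity zero = inj₁ (0 , refl)
parity (suc n) with parity n
... | inj₁ (g , refl) = inj₂ (g , refl)
... | inj₂ (g , refl) = inj₁ (suc g , refl)

2∤suc[2n] : ∀ n → ¬ 2 ∣ suc (n * 2)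
2∤suc[2n] n (divides q eq) = even≢odd q n (trans (*-comm 2 q) (trans (sym eq) (cong suc (*-comm n 2))))

even-modulus : ∀ {d} → 7 ≤ d → 2 ∣ d → Σ[ h ∈ ℕ ] d ≡ 8 + h * 2
even-modulus {d} 7≤d 2∣d with parity (d ∸ 7) | m+[n∸m]≡n 7≤d
... | inj₁ (g , e≡) | d≡ = ⊥-elim (2∤suc[2n] (3 + g) (subst (2 ∣_) (trans (sym d≡) (cong (7 +_) e≡)) 2∣d))
... | inj₂ (h , e≡) | d≡ = h , trans (sym d≡) (cong (7 +_) e≡)

odd-modulus : ∀ {d} → 7 ≤ d → ¬ 2 ∣ d → Σ[ g ∈ ℕ ] d ≡ 7 + g * 2
odd-modulus {d} 7≤d 2∤d with parity (d ∸ 7) | m+[n∸m]≡n 7≤d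
... | inj₁ (g , e≡) | d≡ = g , trans (sym d≡) (cong (7 +_) e≡)
... | inj₂ (h , e≡) | d≡ = ⊥-elim (2∤d (divides (4 + h) (trans (sym d≡) (cong (7 +_) e≡))))

theorem3p1p10 : (d k : ℕ) → 7 ≤ d → 1 ≤ k →
    ((2 ∣ d) → (n : ℕ) →
      (n ≡ k * d ∸ 1) ⊎ (n ≡ (k + 1) * d + 1) ⊎ (n ≡ (k + 3) * d ∸ 3) →
      AWinsZ n d)
    ×
    (¬ (2 ∣ d) → (n : ℕ) →
      (n ≡ (2 * k ∸ 1) * d ∸ 2) ⊎ (n ≡ (2 * k ∸ 1) * d) ⊎ (n ≡ 2 * k * d ∸ 1) ⊎
      (n ≡ 2 * k * d + 1) ⊎ (n ≡ (2 * k + 1) * d + 2) ⊎ (n ≡ 2 * (k + 1) * d ∸ 3) →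
      AWinsZ n d)
theorem3p1p10 d (suc k) 7≤d _ = even-case , odd-case
  where
  even-case : 2 ∣ d → ∀ n →
    (n ≡ suc k * d ∸ 1) ⊎ (n ≡ (suc k + 1) * d + 1) ⊎ (n ≡ (suc k + 3) * d ∸ 3) → AWinsZ n d
  even-case 2∣d with even-modulus 7≤d 2∣d
  ... | h , refl = EvenModulus.wins h k
  odd-case : ¬ 2 ∣ d → ∀ n →
    (n ≡ (2 * suc k ∸ 1) * d ∸ 2) ⊎ (n ≡ (2 * suc k ∸ 1) * d) ⊎ (n ≡ 2 * suc k * d ∸ 1) ⊎
    (n ≡ 2 * suc k * d + 1) ⊎ (n ≡ (2 * suc k + 1) * d + 2) ⊎ (n ≡ 2 * (suc k + 1) * d ∸ 3) → AWinsZ n d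
  odd-case 2∤d with odd-modulus 7≤d 2∤d
  ... | g , refl = OddModulus.wins g k
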